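{- Let $p\neq q$ be primes. (a) If $1\le a\le m$ and $1\le b\le n$ are integers, then $\langle p^a,q^b\rangle\le_P\langle p^m,q^n\rangle$. (b) If $n\ge1$ and $a,b\ge1$ are integers with $2\le a+b\le n+1$, then $\langle p^a,q^b\rangle\le_P B_n(p,q)$, where $B_n(p,q)=\langle p^n,p^{n-1}q,\dots,pq^{n-1},q^n\rangle$. (c) Let $V$ be a numerical semigroup generated by $\{n_1,\dots,n_k\}$, let $d=\gcd(n_1,\dots,n_{k-1})$ and let $U=\langle n_1/d,\dots,n_{k-1}/d,n_k\rangle$. Then $U$ and $V$ are polynomially related (namely $U\le_P V$).
   Context: A numerical semigroup is a submonoid of $(\mathbb N,+)$ with finite complement; $\langle A\rangle$ denotes the submonoid of $\mathbb N$ generated by $A$. $\mathrm H_S(x)=\sum_{s\in S}x^s$. For numerical semigroups $S,T$, $S\le_P T$ (polynomially related) means there exist $f\in\mathbb Z[x]$ and an integer $w\ge1$ with $\mathrm H_S(x^w)f(x)=\mathrm H_T(x)$. -}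

module Defs where

open import Data.Nat using (ℕ; zero; suc; _+_; _*_; _≤_; _≟_; _/_)
open import Data.Nat.GCD using (gcd)
open import Data.Integer as ℤ using (ℤ; +_)
open import Data.List using (List; []; _∷_; foldr)
open import Data.List.Membership.Propositional using (_∈_)
open import Data.Product using (Σ; ∃; _×_; _,_)
open import Relation.Nullary using (¬_; does)
open import Relation.Binary.PropositionalEquality using (_≡_)
open import Data.Bool using (if_then_else_)

Subset : Set₁
Subset = ℕ → Set

data ⟨_⟩ (A : List ℕ) : ℕ → Set where
  gen-zero : ⟨ A ⟩ 0
  gen-step : ∀ {a s} → a ∈ A → ⟨ A ⟩ s → ⟨ A ⟩ (a + s)

record IsNumericalSemigroup (S : Subset) : Set where
  field
    zero∈  : S 0
    +-closed : ∀ {m n} → S m → S n → S (m + n)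
    cofinite : ∃ λ N → ∀ n → N ≤ n → S n

IsIndicator : Subset → (ℕ → ℤ) → Set
IsIndicator S χ = ∀ n → (S n → χ n ≡ + 1) × (¬ S n → χ n ≡ + 0)

sumBelow : ℕ → (ℕ → ℤ) → ℤ
sumBelow zero    g = + 0
sumBelow (suc n) g = sumBelow n g ℤ.+ g n

-- coefficient list of a polynomial in ℤ[x] (constant term first)
coeff : List ℤ → ℕ → ℤ
coeff []       _       = + 0
coeff (c ∷ cs) zero    = c
coeff (c ∷ cs) (suc i) = coeff cs i

length' : List ℤ → ℕ
length' []       = 0
length' (_ ∷ cs) = suc (length' cs)

-- n-th coefficient of the power series H(x^w) · f(x), where H(x) = Σ_k χ k x^k:
--   Σ_{i < deg f + 1} Σ_{k ≤ n, i + w k = n} f_i χ(k)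
dilProdCoeff : (ℕ → ℤ) → ℕ → List ℤ → ℕ → ℤ
dilProdCoeff χ w f n =
  sumBelow (length' f) λ i →
    sumBelow (suc n) λ k →
      if does (i + w * k ≟ n) then coeff f i ℤ.* χ k else + 0

-- S ≤_P T : ∃ f ∈ ℤ[x], w ≥ 1 with H_S(x^w) f(x) = H_T(x) (as formal power series).
_≤P_ : Subset → Subset → Set
S ≤P T = Σ (List ℤ) λ f → Σ ℕ λ w → (1 ≤ w) ×
  Σ (ℕ → ℤ) λ χS → Σ (ℕ → ℤ) λ χT →
    IsIndicator S χS × IsIndicator T χT ×
    (∀ n → dilProdCoeff χS w f n ≡ χT n)

gcdList : List ℕ → ℕ
gcdList = foldr gcd 0

-- m / d, with the (unused) convention m / 0 = 0
_div_ : ℕ → ℕ → ℕ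
m div zero  = 0
m div suc d = m / suc d

-- If V = P G + Q H with Q ∈ G, P ∈ H and gcd(P, Q) = 1 (a gluing), every element of V is
-- P u + Q v with u unique in the Apéry set of G with respect to Q, and so
-- H_V(x) = (1 - x^{PQ}) H_G(x^P) H_H(x^Q).  All semigroups in the theorem are gluings:
-- ⟨X, Y⟩ of ℕ with ℕ, B_{a+1+c} of B_c with B_a along p^{a+1} and q^{c+1}, and V of U with ℕ
-- along d and n_k.  Substituting x^{αβ} into the formula for ⟨X, Y⟩ gives the shape of the
-- formula for a gluing along αX and βY, and corresponding factors differ by polynomials
-- (1 - x^{rk}) H(x^k) because the semigroups involved are cofinite.

module Submission where

open import Defs
open import Data.Nat as ℕ
  using (ℕ; zero; suc; _+_; _*_; _∸_; _^_; _≤_; _<_; z≤n; s≤s; _≤?_; _<?_; NonZero; >-nonZero)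
import Data.Nat.Properties as ℕ
open import Data.Nat.Divisibility using (_∣_; divides; _∣?_)
open import Data.Nat.Coprimality as Coprime using (Coprime; coprime-divisor; coprime-Bézout)
open import Data.Nat.GCD using (module Bézout; gcd[m,n]∣m; gcd[m,n]∣n)
open import Data.Nat.DivMod using (_%_; _/_; m%n<n; m≡m%n+[m/n]*n)
open import Data.Nat.Primality using (Prime; prime⇒irreducible; prime⇒nonTrivial; prime⇒nonZero)
open import Induction.WellFounded using (Acc; acc)
open import Data.Nat.Induction using (<-wellFounded)
import Data.Nat.Divisibility as ∣
import Data.Nat.Tactic.RingSolver as ℕ-Solver
open import Data.Integer as ℤ using (ℤ; 0ℤ; 1ℤ)
import Data.Integer.Properties as ℤ
open import Data.Integer.Tactic.RingSolver using (solve-∀)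
open import Data.Bool using (if_then_else_)
open import Data.Unit using (tt)
open import Data.Product using (∃; ∃₂; _×_; _,_; proj₁; proj₂)
open import Data.Sum using (_⊎_; inj₁; inj₂; [_,_]′)
open import Data.List using (List; []; _∷_; map; upTo; _∷ʳ_)
open import Data.List.Membership.Propositional.Properties
  using (∈-map⁺; ∈-map⁻; ∈-upTo⁺; ∈-upTo⁻; ∈-++⁺ˡ; ∈-++⁺ʳ; ∈-++⁻)
open import Data.List.Membership.Propositional using (_∈_; find; lose)
open import Data.List.Relation.Unary.All as All using (All)
open import Data.List.Relation.Unary.Any using (Any; here; there; any?)
open import Data.Vec using ([]; _∷_)
open import Data.Fin using (#_)
open import Function using (_∘_)
open import Level using (0ℓ)
open import Relation.Binary using (Setoid)
open import Relation.Binary.PropositionalEquality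
open import Relation.Nullary using (¬_; Dec; yes; no; does; contradiction)
open import Relation.Nullary.Decidable using (dec-true; dec-false; _×-dec_; ¬?; map′)
open import Relation.Unary using (Decidable; U)
open import Relation.Unary.Properties using (U?)
open import Algebra.Bundles using (CommutativeMonoid)

sumBelow-cong : ∀ N {g h : ℕ → ℤ} → (∀ i → i < N → g i ≡ h i) → sumBelow N g ≡ sumBelow N h
sumBelow-cong zero    eq = refl
sumBelow-cong (suc N) eq =
  cong₂ ℤ._+_ (sumBelow-cong N λ i i<N → eq i (ℕ.m<n⇒m<1+n i<N)) (eq N ℕ.≤-refl)

sumBelow-zero : ∀ N {g : ℕ → ℤ} → (∀ i → i < N → g i ≡ 0ℤ) → sumBelow N g ≡ 0ℤ
sumBelow-zero N eq = trans (sumBelow-cong N eq) (constant N)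
  where
  constant : ∀ N → sumBelow N (λ _ → 0ℤ) ≡ 0ℤ
  constant zero    = refl
  constant (suc N) = cong (ℤ._+ 0ℤ) (constant N)

sumBelow-single : ∀ N {g : ℕ → ℤ} k → k < N → (∀ i → i < N → i ≢ k → g i ≡ 0ℤ) →
                  sumBelow N g ≡ g k
sumBelow-single (suc N) {g} k k<1+N others with k ℕ.≟ N
... | yes refl = trans (cong (ℤ._+ g N) rest-zero) (ℤ.+-identityˡ (g N))
  where
  rest-zero = sumBelow-zero N λ i i<N → others i (ℕ.m<n⇒m<1+n i<N) (ℕ.<⇒≢ i<N)
... | no k≢N = trans (cong₂ ℤ._+_ rest (others N ℕ.≤-refl (k≢N ∘ sym))) (ℤ.+-identityʳ (g k))
  where
  rest = sumBelow-single N k (ℕ.≤∧≢⇒< (ℕ.≤-pred k<1+N) k≢N)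
           λ i i<N → others i (ℕ.m<n⇒m<1+n i<N)

sumBelow-head : ∀ N (g : ℕ → ℤ) → sumBelow (suc N) g ≡ g 0 ℤ.+ sumBelow N (g ∘ suc)
sumBelow-head zero    g = trans (ℤ.+-identityˡ (g 0)) (sym (ℤ.+-identityʳ (g 0)))
sumBelow-head (suc N) g = trans (cong (ℤ._+ g (suc N)) (sumBelow-head N g)) (ℤ.+-assoc (g 0) _ _)

sumBelow-vanishing : ∀ {M N} {g : ℕ → ℤ} → M ≤ N → (∀ i → M ≤ i → g i ≡ 0ℤ) →
                     sumBelow N g ≡ sumBelow M g
sumBelow-vanishing {M} {N} {g} M≤N vanish =
  subst (λ N → sumBelow N g ≡ sumBelow M g) (ℕ.m+[n∸m]≡n M≤N) (extend (N ∸ M))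
  where
  extend : ∀ K → sumBelow (M + K) g ≡ sumBelow M g
  extend zero    = cong (λ N → sumBelow N g) (ℕ.+-identityʳ M)
  extend (suc K) rewrite ℕ.+-suc M K =
    trans (cong₂ ℤ._+_ (extend K) (vanish (M + K) (ℕ.m≤m+n M K))) (ℤ.+-identityʳ _)

Series : Set
Series = ℕ → ℤ

open Setoid (ℕ →-setoid ℤ) using () renaming (refl to ≗-refl; sym to ≗-sym; trans to ≗-trans)

infixl 6 _⊕_ _⊖_
infixl 7 _·_ _⊛_

_⊕_ _⊖_ : Series → Series → Series
(s ⊕ t) n = s n ℤ.+ t n
(s ⊖ t) n = s n ℤ.- t n

_·_ : ℤ → Series → Series
(c · s) n = c ℤ.* s n

zeroₛ oneₛ : Series
zeroₛ _       = 0ℤ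
oneₛ zero    = 1ℤ
oneₛ (suc n) = 0ℤ

tail : Series → Series
tail s = s ∘ suc

shift : Series → Series
shift s zero    = 0ℤ
shift s (suc n) = s n

shiftBy : ℕ → Series → Series
shiftBy zero    s = s
shiftBy (suc k) s = shift (shiftBy k s)

-- The Cauchy product, by recursion on the first factor so that its laws follow by induction.
_⊛_ : Series → Series → Series
(s ⊛ t) zero    = s 0 ℤ.* t 0
(s ⊛ t) (suc n) = s 0 ℤ.* t (suc n) ℤ.+ (tail s ⊛ t) n

⊛-cong : ∀ {s s′ t t′} → s ≗ s′ → t ≗ t′ → s ⊛ t ≗ s′ ⊛ t′
⊛-cong ps pt zero    = cong₂ ℤ._*_ (ps 0) (pt 0)
⊛-cong ps pt (suc n) = cong₂ ℤ._+_ (cong₂ ℤ._*_ (ps 0) (pt (suc n))) (⊛-cong (ps ∘ suc) pt n)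

⊛-as-sum : ∀ s t n → (s ⊛ t) n ≡ sumBelow (suc n) (λ k → s k ℤ.* t (n ∸ k))
⊛-as-sum s t zero    = sym (ℤ.+-identityˡ _)
⊛-as-sum s t (suc n) =
  trans (cong (λ z → s 0 ℤ.* t (suc n) ℤ.+ z) (⊛-as-sum (tail s) t n))
        (sym (sumBelow-head (suc n) (λ k → s k ℤ.* t (suc n ∸ k))))

⊛-unfoldˡ : ∀ s t → s ⊛ t ≗ s 0 · t ⊕ shift (tail s ⊛ t)
⊛-unfoldˡ s t zero    = sym (ℤ.+-identityʳ _)
⊛-unfoldˡ s t (suc n) = refl

⊛-unfoldʳ : ∀ s t → s ⊛ t ≗ t 0 · s ⊕ shift (s ⊛ tail t)
⊛-unfoldʳ s t zero = trans (ℤ.*-comm (s 0) (t 0)) (sym (ℤ.+-identityʳ _))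
⊛-unfoldʳ s t (suc zero) = swap (s 0) (s 1) (t 0) (t 1)
  where
  swap : ∀ a b c d → a ℤ.* d ℤ.+ b ℤ.* c ≡ c ℤ.* b ℤ.+ a ℤ.* d
  swap = solve-∀
⊛-unfoldʳ s t (suc (suc n)) rewrite ⊛-unfoldʳ (tail s) t (suc n) =
  swap (s 0) (s (2 + n)) (t 0) (t (2 + n)) ((tail s ⊛ tail t) n)
  where
  swap : ∀ a b c d e → a ℤ.* d ℤ.+ (c ℤ.* b ℤ.+ e) ≡ c ℤ.* b ℤ.+ (a ℤ.* d ℤ.+ e)
  swap = solve-∀

⊛-distribʳ-⊕ : ∀ s s′ t → (s ⊕ s′) ⊛ t ≗ s ⊛ t ⊕ s′ ⊛ t
⊛-distribʳ-⊕ s s′ t zero    = ℤ.*-distribʳ-+ (t 0) (s 0) (s′ 0)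
⊛-distribʳ-⊕ s s′ t (suc n) rewrite ⊛-distribʳ-⊕ (tail s) (tail s′) t n =
  distrib (s 0) (s′ 0) (t (suc n)) ((tail s ⊛ t) n) ((tail s′ ⊛ t) n)
  where
  distrib : ∀ a b c d e → (a ℤ.+ b) ℤ.* c ℤ.+ (d ℤ.+ e) ≡ (a ℤ.* c ℤ.+ d) ℤ.+ (b ℤ.* c ℤ.+ e)
  distrib = solve-∀

⊛-distribʳ-⊖ : ∀ s s′ t → (s ⊖ s′) ⊛ t ≗ s ⊛ t ⊖ s′ ⊛ t
⊛-distribʳ-⊖ s s′ t zero    = distrib (s 0) (s′ 0) (t 0)
  where
  distrib : ∀ a b c → (a ℤ.- b) ℤ.* c ≡ a ℤ.* c ℤ.- b ℤ.* c
  distrib = solve-∀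
⊛-distribʳ-⊖ s s′ t (suc n) rewrite ⊛-distribʳ-⊖ (tail s) (tail s′) t n =
  distrib (s 0) (s′ 0) (t (suc n)) ((tail s ⊛ t) n) ((tail s′ ⊛ t) n)
  where
  distrib : ∀ a b c d e → (a ℤ.- b) ℤ.* c ℤ.+ (d ℤ.- e) ≡ (a ℤ.* c ℤ.+ d) ℤ.- (b ℤ.* c ℤ.+ e)
  distrib = solve-∀

⊛-assoc-· : ∀ c s t → (c · s) ⊛ t ≗ c · (s ⊛ t)
⊛-assoc-· c s t zero    = ℤ.*-assoc c (s 0) (t 0)
⊛-assoc-· c s t (suc n) rewrite ⊛-assoc-· c (tail s) t n =
  distrib c (s 0) (t (suc n)) ((tail s ⊛ t) n)
  where
  distrib : ∀ a b d e → a ℤ.* b ℤ.* d ℤ.+ a ℤ.* e ≡ a ℤ.* (b ℤ.* d ℤ.+ e)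
  distrib = solve-∀

⊛-shiftˡ : ∀ s t → shift s ⊛ t ≗ shift (s ⊛ t)
⊛-shiftˡ s t zero    = refl
⊛-shiftˡ s t (suc n) = ℤ.+-identityˡ _

⊛-zeroˡ : ∀ t → zeroₛ ⊛ t ≗ zeroₛ
⊛-zeroˡ t zero    = refl
⊛-zeroˡ t (suc n) rewrite ⊛-zeroˡ t n = refl

⊛-identityˡ : ∀ t → oneₛ ⊛ t ≗ t
⊛-identityˡ t zero    = ℤ.*-identityˡ (t 0)
⊛-identityˡ t (suc n) rewrite ⊛-zeroˡ t n = trans (ℤ.+-identityʳ _) (ℤ.*-identityˡ _)

⊛-comm : ∀ s t → s ⊛ t ≗ t ⊛ s
⊛-comm s t zero    = ℤ.*-comm (s 0) (t 0)
⊛-comm s t (suc n) =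
  trans (cong (λ z → s 0 ℤ.* t (suc n) ℤ.+ z) (⊛-comm (tail s) t n)) (sym (⊛-unfoldʳ t s (suc n)))

⊛-assoc : ∀ s t u → (s ⊛ t) ⊛ u ≗ s ⊛ (t ⊛ u)
⊛-assoc s t u zero    = ℤ.*-assoc (s 0) (t 0) (u 0)
⊛-assoc s t u (suc n) = begin
  ((s ⊛ t) ⊛ u) (suc n)
    ≡⟨ ⊛-cong (⊛-unfoldˡ s t) (λ _ → refl) (suc n) ⟩
  ((s 0 · t ⊕ shift (tail s ⊛ t)) ⊛ u) (suc n)
    ≡⟨ ⊛-distribʳ-⊕ (s 0 · t) (shift (tail s ⊛ t)) u (suc n) ⟩
  ((s 0 · t) ⊛ u) (suc n) ℤ.+ (shift (tail s ⊛ t) ⊛ u) (suc n)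
    ≡⟨ cong₂ ℤ._+_ (⊛-assoc-· (s 0) t u (suc n)) (⊛-shiftˡ (tail s ⊛ t) u (suc n)) ⟩
  s 0 ℤ.* (t ⊛ u) (suc n) ℤ.+ ((tail s ⊛ t) ⊛ u) n
    ≡⟨ cong (λ z → s 0 ℤ.* (t ⊛ u) (suc n) ℤ.+ z) (⊛-assoc (tail s) t u n) ⟩
  (s ⊛ (t ⊛ u)) (suc n) ∎
  where open ≡-Reasoning

⊛-commutativeMonoid : CommutativeMonoid 0ℓ 0ℓ
⊛-commutativeMonoid = record
  { Carrier = Series
  ; _≈_     = _≗_
  ; _∙_     = _⊛_
  ; ε       = oneₛ
  ; isCommutativeMonoid = record
    { isMonoid = record
      { isSemigroup = record
        { isMagma = record
          { isEquivalence = Setoid.isEquivalence (ℕ →-setoid ℤ)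
          ; ∙-cong        = ⊛-cong
          }
        ; assoc = ⊛-assoc
        }
      ; identity = ⊛-identityˡ , λ t → ≗-trans (⊛-comm t oneₛ) (⊛-identityˡ t)
      }
    ; comm = ⊛-comm
    }
  }

shift-cong : ∀ {s t} → s ≗ t → shift s ≗ shift t
shift-cong eq zero    = refl
shift-cong eq (suc n) = eq n

shiftBy-+ : ∀ k s j → shiftBy k s (k + j) ≡ s j
shiftBy-+ zero    s j = refl
shiftBy-+ (suc k) s j = shiftBy-+ k s j

shiftBy-< : ∀ k s {n} → n < k → shiftBy k s n ≡ 0ℤ
shiftBy-< (suc k) s {zero}  _         = refl
shiftBy-< (suc k) s {suc n} (s≤s n<k) = shiftBy-< k s n<k

shiftBy-oneₛ-⊛ : ∀ k t → shiftBy k oneₛ ⊛ t ≗ shiftBy k t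
shiftBy-oneₛ-⊛ zero    t = ⊛-identityˡ t
shiftBy-oneₛ-⊛ (suc k) t = ≗-trans (⊛-shiftˡ (shiftBy k oneₛ) t) (shift-cong (shiftBy-oneₛ-⊛ k t))

1-x^_ : ℕ → Series
1-x^ m = oneₛ ⊖ shiftBy m oneₛ

1-x^-⊛ : ∀ m t → 1-x^ m ⊛ t ≗ t ⊖ shiftBy m t
1-x^-⊛ m t n =
  trans (⊛-distribʳ-⊖ oneₛ (shiftBy m oneₛ) t n)
        (cong₂ ℤ._-_ (⊛-identityˡ t n) (shiftBy-oneₛ-⊛ m t n))

-- dilate k s is s(x^k); the value of the junk case k = 0 is irrelevant.
dilate : ℕ → Series → Series
dilate k s n with k ∣? n
... | yes (divides q _) = s q
... | no _              = 0ℤ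

dilate-cong : ∀ k {s t} → s ≗ t → dilate k s ≗ dilate k t
dilate-cong k s≗t n with k ∣? n
... | yes (divides q _) = s≗t q
... | no _              = refl

module _ {k : ℕ} (1≤k : 1 ≤ k) where

  private instance
    k≢0 : NonZero k
    k≢0 = >-nonZero 1≤k

  dilate-on : ∀ s {n j} → n ≡ k * j → dilate k s n ≡ s j
  dilate-on s {n} {j} n≡kj with k ∣? n
  ... | yes (divides q n≡qk) = cong s (ℕ.*-cancelˡ-≡ q j k (trans (trans (ℕ.*-comm k q) (sym n≡qk)) n≡kj))
  ... | no k∤n               = contradiction (divides j (trans n≡kj (ℕ.*-comm k j))) k∤n

  dilate-off : ∀ s {n} → ¬ k ∣ n → dilate k s n ≡ 0ℤ
  dilate-off s {n} k∤n with k ∣? n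
  ... | yes k∣n = contradiction k∣n k∤n
  ... | no _    = refl

  dilate-shiftBy : ∀ r s j → dilate k (shiftBy r s) (k * r + j) ≡ dilate k s j
  dilate-shiftBy r s j with k ∣? j
  ... | yes (divides q j≡qk) =
        trans (dilate-on (shiftBy r s) (trans (cong ((k * r) +_) (trans j≡qk (ℕ.*-comm q k)))
                                               (sym (ℕ.*-distribˡ-+ k r q))))
              (shiftBy-+ r s q)
  ... | no k∤j = dilate-off (shiftBy r s) λ k∣kr+j → k∤j (∣.∣m+n∣m⇒∣n k∣kr+j (∣.m∣m*n r))

  shiftBy-dilate : ∀ r s → shiftBy (k * r) (dilate k s) ≗ dilate k (shiftBy r s)
  shiftBy-dilate r s n with n <? k * r
  ... | yes n<kr = trans (shiftBy-< (k * r) (dilate k s) n<kr) (sym (below (k ∣? n)))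
    where
    below : Dec (k ∣ n) → dilate k (shiftBy r s) n ≡ 0ℤ
    below (yes (divides q n≡qk)) =
      trans (dilate-on (shiftBy r s) (trans n≡qk (ℕ.*-comm q k)))
            (shiftBy-< r s (ℕ.*-cancelˡ-< k q r (subst (_< k * r) (trans n≡qk (ℕ.*-comm q k)) n<kr)))
    below (no k∤n) = dilate-off (shiftBy r s) k∤n
  ... | no n≮kr =
        subst (λ n → shiftBy (k * r) (dilate k s) n ≡ dilate k (shiftBy r s) n) (ℕ.m+[n∸m]≡n kr≤n)
              (trans (shiftBy-+ (k * r) (dilate k s) (n ∸ k * r)) (sym (dilate-shiftBy r s (n ∸ k * r))))
    where kr≤n = ℕ.≮⇒≥ n≮kr

  dilate-⊖ : ∀ s t → dilate k s ⊖ dilate k t ≗ dilate k (s ⊖ t)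
  dilate-⊖ s t n with k ∣? n
  ... | yes _ = refl
  ... | no _  = refl

  1-x^-⊛-dilate : ∀ r s → 1-x^ (k * r) ⊛ dilate k s ≗ dilate k (1-x^ r ⊛ s)
  1-x^-⊛-dilate r s = begin
    1-x^ (k * r) ⊛ dilate k s                ≈⟨ 1-x^-⊛ (k * r) (dilate k s) ⟩
    dilate k s ⊖ shiftBy (k * r) (dilate k s) ≈⟨ (λ n → cong (ℤ._-_ (dilate k s n)) (shiftBy-dilate r s n)) ⟩
    dilate k s ⊖ dilate k (shiftBy r s)       ≈⟨ dilate-⊖ s (shiftBy r s) ⟩
    dilate k (s ⊖ shiftBy r s)                ≈⟨ dilate-cong k (≗-sym (1-x^-⊛ r s)) ⟩
    dilate k (1-x^ r ⊛ s)                     ∎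
    where open import Relation.Binary.Reasoning.Setoid (ℕ →-setoid ℤ)

  dilate-oneₛ : dilate k oneₛ ≗ oneₛ
  dilate-oneₛ zero    = dilate-on oneₛ (sym (ℕ.*-zeroʳ k))
  dilate-oneₛ (suc n) with k ∣? suc n
  ... | yes (divides zero    1+n≡0) = contradiction 1+n≡0 λ ()
  ... | yes (divides (suc q) _)     = refl
  ... | no _                        = refl

dilate-1 : ∀ s → dilate 1 s ≗ s
dilate-1 s n = dilate-on ℕ.≤-refl s (sym (ℕ.*-identityˡ n))

ones : Series
ones _ = 1ℤ

geometric : ℕ → Series
geometric m = dilate m ones

1-x^-⊛-geometric : ∀ {m} → 1 ≤ m → 1-x^ m ⊛ geometric m ≗ oneₛ
1-x^-⊛-geometric {m} 1≤m n = begin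
  (1-x^ m ⊛ geometric m) n           ≡⟨ cong (λ k → (1-x^ k ⊛ geometric m) n) (sym (ℕ.*-identityʳ m)) ⟩
  (1-x^ (m * 1) ⊛ dilate m ones) n   ≡⟨ 1-x^-⊛-dilate 1≤m 1 ones n ⟩
  dilate m (1-x^ 1 ⊛ ones) n         ≡⟨ dilate-cong m telescope n ⟩
  dilate m oneₛ n                    ≡⟨ dilate-oneₛ 1≤m n ⟩
  oneₛ n                             ∎
  where
  open ≡-Reasoning
  telescope : 1-x^ 1 ⊛ ones ≗ oneₛ
  telescope = ≗-trans (1-x^-⊛ 1 ones) λ { zero → refl ; (suc n) → refl }

DegreeBelow : ℕ → Series → Set
DegreeBelow L s = ∀ j → L ≤ j → s j ≡ 0ℤ

DegreeBelow-cong : ∀ {L s t} → s ≗ t → DegreeBelow L s → DegreeBelow L t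
DegreeBelow-cong s≗t deg j L≤j = trans (sym (s≗t j)) (deg j L≤j)

DegreeBelow-⊛ : ∀ {A B s t} → DegreeBelow A s → DegreeBelow B t → DegreeBelow (A + B) (s ⊛ t)
DegreeBelow-⊛ {A} {B} {s} {t} degˢ degᵗ n A+B≤n =
  trans (⊛-as-sum s t n) (sumBelow-zero (suc n) λ k k≤n → vanish k (ℕ.≤-pred k≤n))
  where
  vanish : ∀ k → k ≤ n → s k ℤ.* t (n ∸ k) ≡ 0ℤ
  vanish k k≤n with k <? A
  ... | no k≮A  = trans (cong (ℤ._* t (n ∸ k)) (degˢ k (ℕ.≮⇒≥ k≮A))) (ℤ.*-zeroˡ (t (n ∸ k)))
  ... | yes k<A = trans (cong (s k ℤ.*_) (degᵗ (n ∸ k) B≤n∸k)) (ℤ.*-zeroʳ (s k))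
    where
    B≤n∸k : B ≤ n ∸ k
    B≤n∸k = ℕ.+-cancelˡ-≤ k B (n ∸ k)
              (subst (k + B ≤_) (sym (ℕ.m+[n∸m]≡n k≤n))
                     (ℕ.≤-trans (ℕ.+-monoˡ-≤ B (ℕ.<⇒≤ k<A)) A+B≤n))

DegreeBelow-dilate : ∀ {k L s} → 1 ≤ k → DegreeBelow L s → DegreeBelow (k * L) (dilate k s)
DegreeBelow-dilate {k} {L} {s} 1≤k deg n kL≤n = vanish (k ∣? n)
  where
  vanish : Dec (k ∣ n) → dilate k s n ≡ 0ℤ
  vanish (yes (divides q n≡qk)) = trans (dilate-on 1≤k s n≡kq) (deg q L≤q)
    where
    n≡kq = trans n≡qk (ℕ.*-comm q k)
    L≤q = ℕ.*-cancelˡ-≤ k {{>-nonZero 1≤k}} (subst (k * L ≤_) n≡kq kL≤n)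
  vanish (no k∤n) = dilate-off 1≤k s k∤n

1-x^-⊛-eventuallyOne : ∀ r {C χ} → (∀ u → C ≤ u → χ u ≡ 1ℤ) → DegreeBelow (r + C) (1-x^ r ⊛ χ)
1-x^-⊛-eventuallyOne r {C} {χ} one n r+C≤n =
  trans (1-x^-⊛ r χ n)
        (subst (λ n → χ n ℤ.- shiftBy r χ n ≡ 0ℤ) (ℕ.m+[n∸m]≡n r≤n)
               (trans (cong₂ ℤ._-_ (one (r + (n ∸ r)) (ℕ.≤-trans C≤n∸r (ℕ.m≤n+m _ r)))
                                   (trans (shiftBy-+ r χ (n ∸ r)) (one (n ∸ r) C≤n∸r)))
                      (ℤ.+-inverseʳ 1ℤ)))
  where
  r≤n = ℕ.≤-trans (ℕ.m≤m+n r C) r+C≤n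
  C≤n∸r = ℕ.+-cancelˡ-≤ r C (n ∸ r) (subst (r + C ≤_) (sym (ℕ.m+[n∸m]≡n r≤n)) r+C≤n)

indicator : {S : Subset} → Decidable S → Series
indicator S? n = if does (S? n) then 1ℤ else 0ℤ

indicator-∈ : ∀ {S : Subset} (S? : Decidable S) {n} → S n → indicator S? n ≡ 1ℤ
indicator-∈ S? {n} sₙ = cong (if_then 1ℤ else 0ℤ) (dec-true (S? n) sₙ)

indicator-∉ : ∀ {S : Subset} (S? : Decidable S) {n} → ¬ S n → indicator S? n ≡ 0ℤ
indicator-∉ S? {n} ¬sₙ = cong (if_then 1ℤ else 0ℤ) (dec-false (S? n) ¬sₙ)

indicator-isIndicator : ∀ {S : Subset} (S? : Decidable S) → IsIndicator S (indicator S?)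
indicator-isIndicator S? n = indicator-∈ S? , indicator-∉ S?

coeff-length : ∀ f {j} → length' f ≤ j → coeff f j ≡ 0ℤ
coeff-length []      _         = refl
coeff-length (c ∷ f) (s≤s len≤j) = coeff-length f len≤j

coefficients : ℕ → Series → List ℤ
coefficients zero    s = []
coefficients (suc L) s = s 0 ∷ coefficients L (tail s)

coeff-coefficients : ∀ {L s} → DegreeBelow L s → coeff (coefficients L s) ≗ s
coeff-coefficients {zero}  deg j       = sym (deg j z≤n)
coeff-coefficients {suc L} deg zero    = refl
coeff-coefficients {suc L} deg (suc j) = coeff-coefficients (λ j L≤j → deg (suc j) (s≤s L≤j)) j

dilProdCoeff-⊛ : ∀ χ {w} → 1 ≤ w → ∀ f n → dilProdCoeff χ w f n ≡ (coeff f ⊛ dilate w χ) n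
dilProdCoeff-⊛ χ {w} 1≤w f n = begin
  dilProdCoeff χ w f n
    ≡⟨ sym (sumBelow-vanishing (ℕ.m≤m+n (length' f) (suc n)) beyond-length) ⟩
  sumBelow (length' f + suc n) term
    ≡⟨ sumBelow-vanishing (ℕ.m≤n+m (suc n) (length' f)) beyond-n ⟩
  sumBelow (suc n) term
    ≡⟨ sumBelow-cong (suc n) (λ i i≤n → term-≤ i (ℕ.≤-pred i≤n)) ⟩
  sumBelow (suc n) (λ i → coeff f i ℤ.* dilate w χ (n ∸ i))
    ≡⟨ sym (⊛-as-sum (coeff f) (dilate w χ) n) ⟩
  (coeff f ⊛ dilate w χ) n ∎
  where
  open ≡-Reasoning
  instance _ = >-nonZero 1≤w

  summand : ℕ → ℕ → ℤ
  summand i k = if does (i + w * k ℕ.≟ n) then coeff f i ℤ.* χ k else 0ℤ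

  term : ℕ → ℤ
  term i = sumBelow (suc n) (summand i)

  if-hit : ∀ {i k} → i + w * k ≡ n → summand i k ≡ coeff f i ℤ.* χ k
  if-hit {i} {k} hit = cong (if_then coeff f i ℤ.* χ k else 0ℤ) (dec-true (i + w * k ℕ.≟ n) hit)

  if-miss : ∀ {i k} → i + w * k ≢ n → summand i k ≡ 0ℤ
  if-miss {i} {k} miss = cong (if_then coeff f i ℤ.* χ k else 0ℤ) (dec-false (i + w * k ℕ.≟ n) miss)

  beyond-length : ∀ i → length' f ≤ i → term i ≡ 0ℤ
  beyond-length i len≤i = sumBelow-zero (suc n) λ k _ → summand-zero k (i + w * k ℕ.≟ n)
    where
    summand-zero : ∀ k → Dec (i + w * k ≡ n) → summand i k ≡ 0ℤ
    summand-zero k (yes hit) =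
      trans (if-hit hit) (trans (cong (ℤ._* χ k) (coeff-length f len≤i)) (ℤ.*-zeroˡ (χ k)))
    summand-zero k (no miss) = if-miss miss

  beyond-n : ∀ i → suc n ≤ i → term i ≡ 0ℤ
  beyond-n i n<i = sumBelow-zero (suc n) λ k _ →
    if-miss λ hit → ℕ.<⇒≱ n<i (subst (i ≤_) hit (ℕ.m≤m+n i (w * k)))

  term-≤ : ∀ i → i ≤ n → term i ≡ coeff f i ℤ.* dilate w χ (n ∸ i)
  term-≤ i i≤n = by-divisibility (w ∣? (n ∸ i))
    where
    by-divisibility : Dec (w ∣ n ∸ i) → term i ≡ coeff f i ℤ.* dilate w χ (n ∸ i)
    by-divisibility (yes (divides q n∸i≡qw)) =
      trans (sumBelow-single (suc n) q q≤n others)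
            (trans (if-hit hit) (cong (coeff f i ℤ.*_) (sym (dilate-on 1≤w χ n∸i≡wq))))
      where
      n∸i≡wq = trans n∸i≡qw (ℕ.*-comm q w)
      hit : i + w * q ≡ n
      hit = trans (cong (i +_) (sym n∸i≡wq)) (ℕ.m+[n∸m]≡n i≤n)
      q≤n : q < suc n
      q≤n = s≤s (ℕ.≤-trans (ℕ.m≤n*m q w) (subst (_≤ n) n∸i≡wq (ℕ.m∸n≤m n i)))
      others : ∀ k → k < suc n → k ≢ q → summand i k ≡ 0ℤ
      others k _ k≢q = if-miss λ hit′ →
        k≢q (ℕ.*-cancelˡ-≡ k q w (ℕ.+-cancelˡ-≡ i _ _ (trans hit′ (sym hit))))
    by-divisibility (no w∤n∸i) =
      trans (sumBelow-zero (suc n) λ k _ → if-miss λ hit → w∤n∸i (divides k (n∸i≡kw hit)))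
            (sym (trans (cong (coeff f i ℤ.*_) (dilate-off 1≤w χ w∤n∸i)) (ℤ.*-zeroʳ (coeff f i))))
      where
      n∸i≡kw : ∀ {k} → i + w * k ≡ n → n ∸ i ≡ k * w
      n∸i≡kw {k} hit = trans (cong (_∸ i) (sym hit)) (trans (ℕ.m+n∸m≡n i (w * k)) (ℕ.*-comm w k))

≤P-intro : ∀ {S T : Subset} (S? : Decidable S) (T? : Decidable T) {w} → 1 ≤ w →
           ∀ {L} f → DegreeBelow L f → dilate w (indicator S?) ⊛ f ≗ indicator T? → S ≤P T
≤P-intro S? T? {w} 1≤w {L} f deg eq =
  coefficients L f , w , 1≤w , indicator S? , indicator T? ,
  indicator-isIndicator S? , indicator-isIndicator T? ,
  λ n → trans (dilProdCoeff-⊛ (indicator S?) 1≤w (coefficients L f) n)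
              (trans (⊛-cong (coeff-coefficients deg) ≗-refl n)
                     (trans (⊛-comm f (dilate w (indicator S?)) n) (eq n)))

dilate-indicator : ∀ k {S : Subset} (S? : Decidable S) n →
                   dilate k (indicator S?) n ≡ 0ℤ ⊎ ∃ λ u → S u × n ≡ k * u
dilate-indicator k S? n with k ∣? n
... | no _ = inj₁ refl
... | yes (divides u n≡uk) with S? u
...   | yes sᵤ = inj₂ (u , sᵤ , trans n≡uk (ℕ.*-comm u k))
...   | no _  = inj₁ refl

record IsGluing (P Q : ℕ) (G H V : Subset) : Set where
  field
    1≤P     : 1 ≤ P
    1≤Q     : 1 ≤ Q
    coprime : Coprime Q P
    G?      : Decidable G
    H?      : Decidable H
    V?      : Decidable V
    G-0     : G 0
    G-+     : ∀ {x y} → G x → G y → G (x + y)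
    Q∈G     : G Q
    H-+     : ∀ {x y} → H x → H y → H (x + y)
    P∈H     : H P
    V⇒      : ∀ {n} → V n → ∃₂ λ u v → G u × H v × n ≡ P * u + Q * v
    V⇐      : ∀ {u v} → G u → H v → V (P * u + Q * v)

module Gluing {P Q : ℕ} {G H V : Subset} (glued : IsGluing P Q G H V) where

  open IsGluing glued

  Apéry : Subset
  Apéry u = G u × ¬ (Q ≤ u × G (u ∸ Q))

  Apéry? : Decidable Apéry
  Apéry? u = G? u ×-dec ¬? (Q ≤? u ×-dec G? (u ∸ Q))

  1-x^Q-⊛-G : 1-x^ Q ⊛ indicator G? ≗ indicator Apéry?
  1-x^Q-⊛-G u = trans (1-x^-⊛ Q (indicator G?) u) (by-size (Q ≤? u))
    where
    χG = indicator G?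
    by-size : Dec (Q ≤ u) → χG u ℤ.- shiftBy Q χG u ≡ indicator Apéry? u
    by-size (no Q≰u) = trans (cong (ℤ._-_ (χG u)) (shiftBy-< Q χG (ℕ.≰⇒> Q≰u))) (by-G (G? u))
      where
      by-G : Dec (G u) → χG u ℤ.- 0ℤ ≡ indicator Apéry? u
      by-G (yes gᵤ) = trans (cong (ℤ._- 0ℤ) (indicator-∈ G? gᵤ)) (sym (indicator-∈ Apéry? (gᵤ , Q≰u ∘ proj₁)))
      by-G (no ¬gᵤ) = trans (cong (ℤ._- 0ℤ) (indicator-∉ G? ¬gᵤ)) (sym (indicator-∉ Apéry? (¬gᵤ ∘ proj₁)))
    by-size (yes Q≤u) = trans (cong (ℤ._-_ (χG u)) shifted) (by-G (G? (u ∸ Q)))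
      where
      shifted : shiftBy Q χG u ≡ χG (u ∸ Q)
      shifted = trans (cong (shiftBy Q χG) (sym (ℕ.m+[n∸m]≡n Q≤u))) (shiftBy-+ Q χG (u ∸ Q))
      by-G : Dec (G (u ∸ Q)) → χG u ℤ.- χG (u ∸ Q) ≡ indicator Apéry? u
      by-G (yes g) =
        trans (cong₂ ℤ._-_ (indicator-∈ G? (subst G (ℕ.m∸n+n≡m Q≤u) (G-+ g Q∈G))) (indicator-∈ G? g))
              (sym (indicator-∉ Apéry? λ ap → proj₂ ap (Q≤u , g)))
      by-G (no ¬g) =
        trans (cong (ℤ._-_ (χG u)) (indicator-∉ G? ¬g))
              (trans (cong (ℤ._- 0ℤ) (by-Apéry (G? u))) (ℤ.+-identityʳ _))
        where
        by-Apéry : Dec (G u) → χG u ≡ indicator Apéry? u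
        by-Apéry (yes gᵤ) = trans (indicator-∈ G? gᵤ) (sym (indicator-∈ Apéry? (gᵤ , ¬g ∘ proj₂)))
        by-Apéry (no ¬gᵤ) = trans (indicator-∉ G? ¬gᵤ) (sym (indicator-∉ Apéry? (¬gᵤ ∘ proj₁)))

  -- Trading Q from u for P in v: P u + Q v = P (u - Q) + Q (v + P).
  toApéry : ∀ {u v} → Acc _<_ u → G u → H v → ∃₂ λ u′ v′ → Apéry u′ × H v′ × P * u + Q * v ≡ P * u′ + Q * v′
  toApéry {u} {v} (acc smaller) gᵤ hᵥ with Q ≤? u
  ... | no Q≰u = u , v , (gᵤ , Q≰u ∘ proj₁) , hᵥ , refl
  ... | yes Q≤u with G? (u ∸ Q)
  ...   | no ¬g = u , v , (gᵤ , ¬g ∘ proj₂) , hᵥ , refl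
  ...   | yes g with toApéry (smaller (ℕ.∸-monoʳ-< {u} {Q} {0} 1≤Q Q≤u)) g (H-+ hᵥ P∈H)
  ...     | u′ , v′ , ap , h , eq = u′ , v′ , ap , h , trans trade eq
    where
    trade : P * u + Q * v ≡ P * (u ∸ Q) + Q * (v + P)
    trade = trans (cong (λ u → P * u + Q * v) (sym (ℕ.m∸n+n≡m Q≤u))) (lemma P Q (u ∸ Q) v)
      where
      lemma : ∀ P Q t v → P * (t + Q) + Q * v ≡ P * t + Q * (v + P)
      lemma = ℕ-Solver.solve-∀

  G-multiple : ∀ j → G (j * Q)
  G-multiple zero    = G-0
  G-multiple (suc j) = G-+ Q∈G (G-multiple j)

  Apéry-unique≤ : ∀ {u u′ v v′} → u ≤ u′ → Apéry u → Apéry u′ → P * u + Q * v ≡ P * u′ + Q * v′ → u ≡ u′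
  Apéry-unique≤ {u} {u′} {v} {v′} u≤u′ (gᵤ , _) (_ , not-reducible) eq =
    by-quotient (coprime-divisor coprime Q∣Pd)
    where
    d = u′ ∸ u
    u′≡u+d : u′ ≡ u + d
    u′≡u+d = sym (ℕ.m+[n∸m]≡n u≤u′)
    Qv≡ : Q * v ≡ Q * v′ + P * d
    Qv≡ = ℕ.+-cancelˡ-≡ (P * u) _ _ (trans eq (trans (cong (λ u′ → P * u′ + Q * v′) u′≡u+d) (lemma P Q u d v′)))
      where
      lemma : ∀ P Q u d v′ → P * (u + d) + Q * v′ ≡ P * u + (Q * v′ + P * d)
      lemma = ℕ-Solver.solve-∀
    Q∣Pd : Q ∣ P * d
    Q∣Pd = ∣.∣m+n∣m⇒∣n (subst (Q ∣_) Qv≡ (∣.m∣m*n v)) (∣.m∣m*n v′)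
    by-quotient : Q ∣ d → u ≡ u′
    by-quotient (divides zero    d≡0)   = sym (trans u′≡u+d (trans (cong (u +_) d≡0) (ℕ.+-identityʳ u)))
    by-quotient (divides (suc j) d≡jQ+Q) =
      contradiction (Q≤u′ , subst G (sym u′∸Q≡) (G-+ gᵤ (G-multiple j))) not-reducible
      where
      u′≡ : u′ ≡ (u + j * Q) + Q
      u′≡ = trans u′≡u+d (trans (cong (u +_) d≡jQ+Q) (lemma u j Q))
        where
        lemma : ∀ u j Q → u + (Q + j * Q) ≡ (u + j * Q) + Q
        lemma = ℕ-Solver.solve-∀
      Q≤u′ = subst (Q ≤_) (sym u′≡) (ℕ.m≤n+m Q _)
      u′∸Q≡ = trans (cong (_∸ Q) u′≡) (ℕ.m+n∸n≡m _ Q)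

  Apéry-unique : ∀ {u u′ v v′} → Apéry u → Apéry u′ → P * u + Q * v ≡ P * u′ + Q * v′ → u ≡ u′
  Apéry-unique {u} {u′} ap ap′ eq with ℕ.≤-total u u′
  ... | inj₁ u≤u′ = Apéry-unique≤ u≤u′ ap ap′ eq
  ... | inj₂ u′≤u = sym (Apéry-unique≤ u′≤u ap′ ap (sym eq))

  module _ {w : ℕ} (1≤w : 1 ≤ w) where

    private
      instance
        w≢0 : NonZero w
        w≢0 = >-nonZero 1≤w
      χApéry = indicator Apéry?
      χH = indicator H?
      χV = indicator V?
      1≤wP = ℕ.*-mono-≤ 1≤w 1≤P
      1≤wQ = ℕ.*-mono-≤ 1≤w 1≤Q
      distribute : ∀ u v → w * (P * u + Q * v) ≡ w * P * u + w * Q * v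
      distribute u v = lemma w P Q u v
        where
        lemma : ∀ w P Q u v → w * (P * u + Q * v) ≡ w * P * u + w * Q * v
        lemma = ℕ-Solver.solve-∀

    Contributes : ℕ → ℕ → Set
    Contributes n k = ∃₂ λ u v → Apéry u × H v × k ≡ w * P * u × n ≡ w * (P * u + Q * v)

    term : ℕ → ℕ → ℤ
    term n k = dilate (w * P) χApéry k ℤ.* dilate (w * Q) χH (n ∸ k)

    term-vanishes-or-contributes : ∀ {n k} → k ≤ n → term n k ≡ 0ℤ ⊎ Contributes n k
    term-vanishes-or-contributes {n} {k} k≤n
      with dilate-indicator (w * P) Apéry? k | dilate-indicator (w * Q) H? (n ∸ k)
    ... | inj₁ miss | _         = inj₁ (trans (cong (ℤ._* right) miss) (ℤ.*-zeroˡ right))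
      where right = dilate (w * Q) χH (n ∸ k)
    ... | inj₂ _    | inj₁ miss = inj₁ (trans (cong (left ℤ.*_) miss) (ℤ.*-zeroʳ left))
      where left = dilate (w * P) χApéry k
    ... | inj₂ (u , ap , k≡wPu) | inj₂ (v , h , n∸k≡wQv) = inj₂ (u , v , ap , h , k≡wPu , n≡)
      where
      n≡ : n ≡ w * (P * u + Q * v)
      n≡ = trans (sym (ℕ.m+[n∸m]≡n k≤n)) (trans (cong₂ _+_ k≡wPu n∸k≡wQv) (sym (distribute u v)))

    term-contributing : ∀ {n u v} → Apéry u → H v → n ≡ w * (P * u + Q * v) → term n (w * P * u) ≡ 1ℤ
    term-contributing {n} {u} {v} ap h n≡ =
      cong₂ ℤ._*_ (trans (dilate-on 1≤wP χApéry refl) (indicator-∈ Apéry? ap))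
                  (trans (dilate-on 1≤wQ χH n∸wPu≡) (indicator-∈ H? h))
      where
      n∸wPu≡ : n ∸ w * P * u ≡ w * Q * v
      n∸wPu≡ = trans (cong (_∸ w * P * u) (trans n≡ (distribute u v))) (ℕ.m+n∸m≡n (w * P * u) (w * Q * v))

    no-contribution : ∀ {n} → (∀ {k} → k ≤ n → ¬ Contributes n k) → sumBelow (suc n) (term n) ≡ 0ℤ
    no-contribution {n} miss = sumBelow-zero (suc n) λ k k<1+n → by-cases (ℕ.≤-pred k<1+n)
      where
      by-cases : ∀ {k} → k ≤ n → term n k ≡ 0ℤ
      by-cases k≤n with term-vanishes-or-contributes k≤n
      ... | inj₁ vanish = vanish
      ... | inj₂ contributes = contradiction contributes (miss k≤n)

    dilate-Apéry-⊛ : dilate (w * P) χApéry ⊛ dilate (w * Q) χH ≗ dilate w χV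
    dilate-Apéry-⊛ n = trans (⊛-as-sum (dilate (w * P) χApéry) (dilate (w * Q) χH) n) (by-divisibility (w ∣? n))
      where
      by-divisibility : Dec (w ∣ n) → sumBelow (suc n) (term n) ≡ dilate w χV n
      by-divisibility (no w∤n) =
        trans (no-contribution λ { _ (u , v , _ , _ , _ , n≡) → w∤n (divides (P * u + Q * v) (trans n≡ (ℕ.*-comm w _))) })
              (sym (dilate-off 1≤w χV w∤n))
      by-divisibility (yes (divides m n≡mw)) = trans (by-membership (V? m)) (sym (dilate-on 1≤w χV n≡wm))
        where
        n≡wm = trans n≡mw (ℕ.*-comm m w)
        by-membership : Dec (V m) → sumBelow (suc n) (term n) ≡ χV m
        by-membership (no ¬vₘ) =
          trans (no-contribution λ { _ (u , v , ap , h , _ , n≡) →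
                  ¬vₘ (subst V (ℕ.*-cancelˡ-≡ _ m w (trans (sym n≡) n≡wm)) (V⇐ (proj₁ ap) h)) })
                (sym (indicator-∉ V? ¬vₘ))
        by-membership (yes vₘ) with V⇒ vₘ
        ... | u₁ , v₁ , g , h , m≡ with toApéry (<-wellFounded u₁) g h
        ...   | u , v , ap , h′ , m≡′ =
                trans (sumBelow-single (suc n) (w * P * u) wPu<1+n others)
                      (trans (term-contributing ap h′ n≡) (sym (indicator-∈ V? vₘ)))
          where
          n≡ : n ≡ w * (P * u + Q * v)
          n≡ = trans n≡wm (cong (w *_) (trans m≡ m≡′))
          wPu<1+n : w * P * u < suc n
          wPu<1+n = s≤s (subst (w * P * u ≤_) (sym (trans n≡ (distribute u v))) (ℕ.m≤m+n _ _))
          others : ∀ k → k < suc n → k ≢ w * P * u → term n k ≡ 0ℤ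
          others k k<1+n k≢ with term-vanishes-or-contributes (ℕ.≤-pred k<1+n)
          ... | inj₁ vanish = vanish
          ... | inj₂ (u′ , v′ , ap′ , _ , k≡ , n≡′) =
                contradiction (trans k≡ (cong (w * P *_) (Apéry-unique ap′ ap same-m))) k≢
            where same-m = ℕ.*-cancelˡ-≡ _ _ w (trans (sym n≡′) n≡)

  gluing : ∀ {w R S N} → 1 ≤ w → R ≡ w * P → S ≡ w * Q → N ≡ R * Q →
           dilate w (indicator V?) ≗ 1-x^ N ⊛ dilate R (indicator G?) ⊛ dilate S (indicator H?)
  gluing {w} 1≤w refl refl refl = ≗-sym (≗-trans (⊛-cong Apéry-factor ≗-refl) (dilate-Apéry-⊛ 1≤w))
    where
    Apéry-factor : 1-x^ (w * P * Q) ⊛ dilate (w * P) (indicator G?) ≗ dilate (w * P) (indicator Apéry?)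
    Apéry-factor = ≗-trans (1-x^-⊛-dilate (ℕ.*-mono-≤ 1≤w 1≤P) Q (indicator G?)) (dilate-cong (w * P) 1-x^Q-⊛-G)

⊛-cancel-units : ∀ e x y x′ y′ z z′ → x ⊛ x′ ≗ oneₛ → y ⊛ y′ ≗ oneₛ →
                 (e ⊛ x ⊛ y) ⊛ ((x′ ⊛ z) ⊛ (y′ ⊛ z′)) ≗ e ⊛ z ⊛ z′
⊛-cancel-units e x y x′ y′ z z′ xx′≗1 yy′≗1 = begin
  (e ⊛ x ⊛ y) ⊛ ((x′ ⊛ z) ⊛ (y′ ⊛ z′))       ≈⟨ regroup ⟩
  (e ⊛ z ⊛ z′) ⊛ ((x ⊛ x′) ⊛ (y ⊛ y′))       ≈⟨ ⊛-cong ≗-refl (⊛-cong xx′≗1 yy′≗1) ⟩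
  (e ⊛ z ⊛ z′) ⊛ (oneₛ ⊛ oneₛ)               ≈⟨ ⊛-cong ≗-refl (⊛-identityˡ oneₛ) ⟩
  (e ⊛ z ⊛ z′) ⊛ oneₛ                        ≈⟨ ⊛-comm _ oneₛ ⟩
  oneₛ ⊛ (e ⊛ z ⊛ z′)                        ≈⟨ ⊛-identityˡ _ ⟩
  e ⊛ z ⊛ z′                                 ∎
  where
  open import Relation.Binary.Reasoning.Setoid (ℕ →-setoid ℤ)
  open import Algebra.Solver.CommutativeMonoid ⊛-commutativeMonoid using (prove; var) renaming (_⊕_ to _∙_)
  regroup = prove 7 (((ᵉ ∙ ˣ) ∙ ʸ) ∙ ((ˣ′ ∙ ᶻ) ∙ (ʸ′ ∙ ᶻ′))) (((ᵉ ∙ ᶻ) ∙ ᶻ′) ∙ ((ˣ ∙ ˣ′) ∙ (ʸ ∙ ʸ′)))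
                  (e ∷ x ∷ y ∷ x′ ∷ y′ ∷ z ∷ z′ ∷ [])
    where
    ᵉ = var (# 0) ; ˣ = var (# 1) ; ʸ = var (# 2) ; ˣ′ = var (# 3)
    ʸ′ = var (# 4) ; ᶻ = var (# 5) ; ᶻ′ = var (# 6)

Cofinite : Subset → Set
Cofinite S = ∃ λ C → ∀ n → C ≤ n → S n

1-x^-⊛-dilate-polynomial : ∀ {k} → 1 ≤ k → ∀ r {S : Subset} (S? : Decidable S) → Cofinite S →
                           ∃ λ L → DegreeBelow L (1-x^ (k * r) ⊛ dilate k (indicator S?))
1-x^-⊛-dilate-polynomial {k} 1≤k r S? (C , full) =
  k * (r + C) ,
  DegreeBelow-cong (≗-sym (1-x^-⊛-dilate 1≤k r (indicator S?)))
    (DegreeBelow-dilate 1≤k (1-x^-⊛-eventuallyOne r λ n C≤n → indicator-∈ S? (full n C≤n)))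

coprime-*ʳ : ∀ {m n o} → Coprime m n → Coprime m o → Coprime m (n * o)
coprime-*ʳ m⊥n m⊥o (d∣m , d∣no) = m⊥o (d∣m , coprime-divisor d⊥n d∣no)
  where
  d⊥n : Coprime _ _
  d⊥n (e∣d , e∣n) = m⊥n (∣.∣-trans e∣d d∣m , e∣n)

coprime-^ʳ : ∀ {m n} k → Coprime m n → Coprime m (n ^ k)
coprime-^ʳ zero    m⊥n (_ , d∣1) = ∣.∣1⇒≡1 d∣1
coprime-^ʳ (suc k) m⊥n = coprime-*ʳ m⊥n (coprime-^ʳ k m⊥n)

coprime-^ : ∀ {m n} j k → Coprime m n → Coprime (m ^ j) (n ^ k)
coprime-^ j k m⊥n = Coprime.sym (coprime-^ʳ j (Coprime.sym (coprime-^ʳ k m⊥n)))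

distinct-primes-coprime : ∀ {p q} → Prime p → Prime q → p ≢ q → Coprime p q
distinct-primes-coprime {p} pp pq p≢q (d∣p , d∣q) with prime⇒irreducible pp d∣p
... | inj₁ d≡1 = d≡1
... | inj₂ refl with prime⇒irreducible pq d∣q
...   | inj₁ p≡1 = contradiction p≡1 (ℕ.nonTrivial⇒≢1 {{prime⇒nonTrivial pp}})
...   | inj₂ p≡q = contradiction p≡q p≢q

-- With 1 + u A = v B, the residue r of t v modulo A satisfies B r ≡ t (mod A) and B r < A B ≤ t.
frobenius′ : ∀ {A B} u v → 1 ≤ A → 1 + u * A ≡ v * B → ∀ {t} → A * B ≤ t → ∃₂ λ x y → t ≡ A * x + B * y
frobenius′ {A} {B} u v 1≤A bézout {t} AB≤t = x , r , sym (trans (ℕ.+-comm (A * x) (B * r)) Br+Ax≡t)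
  where
  instance _ = >-nonZero 1≤A
  r = (t * v) % A
  k = (t * v) / A
  Br≤t : B * r ≤ t
  Br≤t = ℕ.≤-trans (ℕ.*-monoʳ-≤ B (ℕ.<⇒≤ (m%n<n (t * v) A))) (subst (_≤ t) (ℕ.*-comm A B) AB≤t)
  multiples : t + t * (u * A) ≡ B * r + B * (k * A)
  multiples = begin
    t + t * (u * A)    ≡⟨ lemma₁ t u A ⟩
    t * (1 + u * A)    ≡⟨ cong (t *_) bézout ⟩
    t * (v * B)        ≡⟨ lemma₂ t v B ⟩
    B * (t * v)        ≡⟨ cong (B *_) (m≡m%n+[m/n]*n (t * v) A) ⟩
    B * (r + k * A)    ≡⟨ ℕ.*-distribˡ-+ B r (k * A) ⟩
    B * r + B * (k * A) ∎
    where
    open ≡-Reasoning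
    lemma₁ : ∀ t u A → t + t * (u * A) ≡ t * (1 + u * A)
    lemma₁ = ℕ-Solver.solve-∀
    lemma₂ : ∀ t v B → t * (v * B) ≡ B * (t * v)
    lemma₂ = ℕ-Solver.solve-∀
  rest : t * (u * A) + (t ∸ B * r) ≡ B * (k * A)
  rest = ℕ.+-cancelˡ-≡ (B * r) _ _
           (trans (lemma (t * (u * A)) (t ∸ B * r) (B * r))
                  (trans (cong (_+ t * (u * A)) (ℕ.m∸n+n≡m Br≤t)) multiples))
    where
    lemma : ∀ a b c → c + (a + b) ≡ (b + c) + a
    lemma = ℕ-Solver.solve-∀
  A∣t∸Br : A ∣ t ∸ B * r
  A∣t∸Br = ∣.∣m+n∣m⇒∣n (subst (A ∣_) (sym rest) (∣.∣n⇒∣m*n B (∣.n∣m*n k))) (∣.∣n⇒∣m*n t (∣.n∣m*n u))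
  x = ∣._∣_.quotient A∣t∸Br
  Br+Ax≡t : B * r + A * x ≡ t
  Br+Ax≡t = trans (cong (B * r +_) (trans (ℕ.*-comm A x) (sym (∣._∣_.equality A∣t∸Br))))
                  (trans (ℕ.+-comm (B * r) _) (ℕ.m∸n+n≡m Br≤t))

frobenius : ∀ {A B} → 1 ≤ A → 1 ≤ B → Coprime A B → ∀ {t} → A * B ≤ t → ∃₂ λ x y → t ≡ A * x + B * y
frobenius {A} {B} 1≤A 1≤B A⊥B {t} AB≤t with coprime-Bézout A⊥B
... | Bézout.-+ x y eq = frobenius′ x y 1≤A eq AB≤t
... | Bézout.+- x y eq with frobenius′ y x 1≤B eq (subst (_≤ t) (ℕ.*-comm A B) AB≤t)
...   | x′ , y′ , t≡ = y′ , x′ , trans t≡ (ℕ.+-comm (B * x′) (A * y′))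

1≤^ : ∀ {x} → 1 ≤ x → ∀ k → 1 ≤ x ^ k
1≤^ {x} 1≤x k = ℕ.m^n>0 x {{>-nonZero 1≤x}} k

^-split : ∀ x {a m} → a ≤ m → x ^ m ≡ x ^ (m ∸ a) * x ^ a
^-split x {a} {m} a≤m = trans (cong (x ^_) (sym (ℕ.m∸n+n≡m a≤m))) (ℕ.^-distribˡ-+-* x (m ∸ a) a)

⟨⟩-+ : ∀ {A x y} → ⟨ A ⟩ x → ⟨ A ⟩ y → ⟨ A ⟩ (x + y)
⟨⟩-+ gen-zero y∈ = y∈
⟨⟩-+ {A} {y = y} (gen-step {a} {s} a∈A s∈) y∈ =
  subst ⟨ A ⟩ (sym (ℕ.+-assoc a s y)) (gen-step a∈A (⟨⟩-+ s∈ y∈))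

⟨⟩-generator : ∀ {A a} → a ∈ A → ⟨ A ⟩ a
⟨⟩-generator {A} {a} a∈A = subst ⟨ A ⟩ (ℕ.+-identityʳ a) (gen-step a∈A gen-zero)

⟨⟩-* : ∀ {A x} j → ⟨ A ⟩ x → ⟨ A ⟩ (j * x)
⟨⟩-* zero    x∈ = gen-zero
⟨⟩-* (suc j) x∈ = ⟨⟩-+ x∈ (⟨⟩-* j x∈)

⟨⟩-scale : ∀ {A B} k → (∀ {a} → a ∈ A → ⟨ B ⟩ (k * a)) → ∀ {x} → ⟨ A ⟩ x → ⟨ B ⟩ (k * x)
⟨⟩-scale {B = B} k gens gen-zero = subst ⟨ B ⟩ (sym (ℕ.*-zeroʳ k)) gen-zero
⟨⟩-scale {B = B} k gens (gen-step {a} {s} a∈A s∈) =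
  subst ⟨ B ⟩ (sym (ℕ.*-distribˡ-+ k a s)) (⟨⟩-+ (gens a∈A) (⟨⟩-scale k gens s∈))

⟨⟩-last : ∀ {A m} → ⟨ A ⟩ m → 1 ≤ m → ∃ λ a → a ∈ A × a ≤ m × ⟨ A ⟩ (m ∸ a)
⟨⟩-last {A} (gen-step {a} {s} a∈A s∈) _ = a , a∈A , ℕ.m≤m+n a s , subst ⟨ A ⟩ (sym (ℕ.m+n∸m≡n a s)) s∈

⟨⟩-dec : ∀ {A} → All (1 ≤_) A → Decidable ⟨ A ⟩
⟨⟩-dec {A} positive n = decide (<-wellFounded n)
  where
  decide : ∀ {n} → Acc _<_ n → Dec (⟨ A ⟩ n)
  decide {zero}  _             = yes gen-zero
  decide {suc n} (acc smaller) = map′ from to (any? lastStep? A)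
    where
    LastStep : ℕ → Set
    LastStep a = 1 ≤ a × a ≤ suc n × ⟨ A ⟩ (suc n ∸ a)
    lastStep? : Decidable LastStep
    lastStep? a with 1 ≤? a | a ≤? suc n
    ... | no 1≰a  | _           = no (1≰a ∘ proj₁)
    ... | yes _   | no a≰1+n    = no (a≰1+n ∘ proj₁ ∘ proj₂)
    ... | yes 1≤a | yes a≤1+n =
          map′ (λ rest → 1≤a , a≤1+n , rest) (proj₂ ∘ proj₂)
               (decide (smaller (ℕ.∸-monoʳ-< {suc n} {a} {0} 1≤a a≤1+n)))
    from : Any LastStep A → ⟨ A ⟩ (suc n)
    from any with find any
    ... | a , a∈A , _ , a≤1+n , rest = subst ⟨ A ⟩ (ℕ.m+[n∸m]≡n a≤1+n) (gen-step a∈A rest)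
    to : ⟨ A ⟩ (suc n) → Any LastStep A
    to 1+n∈ with ⟨⟩-last 1+n∈ (s≤s z≤n)
    ... | a , a∈A , a≤1+n , rest = lose a∈A (All.lookup positive a∈A , a≤1+n , rest)

⟨⟩-pair⇒ : ∀ {x y n} → ⟨ x ∷ y ∷ [] ⟩ n → ∃₂ λ u v → n ≡ x * u + y * v
⟨⟩-pair⇒ {x} {y} gen-zero = 0 , 0 , sym (cong₂ _+_ (ℕ.*-zeroʳ x) (ℕ.*-zeroʳ y))
⟨⟩-pair⇒ {x} {y} (gen-step (here refl) n∈) with ⟨⟩-pair⇒ n∈
... | u , v , n≡ = suc u , v , trans (cong (x +_) n≡) (lemma x y u v)
  where
  lemma : ∀ x y u v → x + (x * u + y * v) ≡ x * suc u + y * v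
  lemma = ℕ-Solver.solve-∀
⟨⟩-pair⇒ {x} {y} (gen-step (there (here refl)) n∈) with ⟨⟩-pair⇒ n∈
... | u , v , n≡ = u , suc v , trans (cong (y +_) n≡) (lemma x y u v)
  where
  lemma : ∀ x y u v → y + (x * u + y * v) ≡ x * u + y * suc v
  lemma = ℕ-Solver.solve-∀

⟨⟩-pair⇐ : ∀ {x y} u v → ⟨ x ∷ y ∷ [] ⟩ (x * u + y * v)
⟨⟩-pair⇐ {x} {y} u v =
  ⟨⟩-+ (subst ⟨ x ∷ y ∷ [] ⟩ (ℕ.*-comm u x) (⟨⟩-* u (⟨⟩-generator (here refl))))
       (subst ⟨ x ∷ y ∷ [] ⟩ (ℕ.*-comm v y) (⟨⟩-* v (⟨⟩-generator (there (here refl)))))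

⟨⟩-pair-isGluing : ∀ {X Y} → 1 ≤ X → 1 ≤ Y → Coprime Y X → IsGluing X Y U U ⟨ X ∷ Y ∷ [] ⟩
⟨⟩-pair-isGluing 1≤X 1≤Y coprime = record
  { 1≤P = 1≤X ; 1≤Q = 1≤Y ; coprime = coprime
  ; G?  = U?  ; H?  = U?  ; V?      = ⟨⟩-dec (1≤X All.∷ 1≤Y All.∷ All.[])
  ; G-0 = tt  ; G-+ = λ _ _ → tt ; Q∈G = tt ; H-+ = λ _ _ → tt ; P∈H = tt
  ; V⇒  = λ n∈ → let u , v , n≡ = ⟨⟩-pair⇒ n∈ in u , v , tt , tt , n≡
  ; V⇐  = λ {u} {v} _ _ → ⟨⟩-pair⇐ u v
  }

-- H_{⟨X,Y⟩}(x^{αβ}) and H_T(x) are both (1 - x^{PQ}) times two factors, and corresponding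
-- factors differ by the polynomials Gfactor and Hfactor.
⟨⟩-pair-≤P-gluing : ∀ {X Y α β P Q G H T} → 1 ≤ X → 1 ≤ Y → Coprime Y X → 1 ≤ α → 1 ≤ β →
                    P ≡ α * X → Q ≡ β * Y → IsGluing P Q G H T → Cofinite G → Cofinite H →
                    ⟨ X ∷ Y ∷ [] ⟩ ≤P T
⟨⟩-pair-≤P-gluing {X} {Y} {α} {β} {P} {Q} 1≤X 1≤Y coprime 1≤α 1≤β refl refl glued G-cofinite H-cofinite =
  ≤P-intro S? T? 1≤αβ (Gfactor ⊛ Hfactor)
    (DegreeBelow-⊛ (proj₂ (1-x^-⊛-dilate-polynomial 1≤P β G? G-cofinite))
                   (proj₂ (1-x^-⊛-dilate-polynomial 1≤Q α H? H-cofinite)))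
    quotient
  where
  pair = ⟨⟩-pair-isGluing 1≤X 1≤Y coprime
  open IsGluing pair using () renaming (V? to S?)
  open IsGluing glued using (1≤P; 1≤Q; G?; H?) renaming (V? to T?)
  χG = indicator G?
  χH = indicator H?
  1≤αβ = ℕ.*-mono-≤ 1≤α 1≤β
  Gfactor = 1-x^ (P * β) ⊛ dilate P χG
  Hfactor = 1-x^ (Q * α) ⊛ dilate Q χH

  source : dilate (α * β) (indicator S?) ≗ 1-x^ (P * Q) ⊛ geometric (P * β) ⊛ geometric (Q * α)
  source = Gluing.gluing pair 1≤αβ (lemma₁ α β X) (lemma₂ α β Y) (lemma₃ α β X Y)
    where
    lemma₁ : ∀ α β X → α * X * β ≡ α * β * X
    lemma₁ = ℕ-Solver.solve-∀
    lemma₂ : ∀ α β Y → β * Y * α ≡ α * β * Y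
    lemma₂ = ℕ-Solver.solve-∀
    lemma₃ : ∀ α β X Y → α * X * (β * Y) ≡ α * X * β * Y
    lemma₃ = ℕ-Solver.solve-∀

  target : indicator T? ≗ 1-x^ (P * Q) ⊛ dilate P χG ⊛ dilate Q χH
  target = ≗-trans (≗-sym (dilate-1 _))
                   (Gluing.gluing glued ℕ.≤-refl (sym (ℕ.*-identityˡ P)) (sym (ℕ.*-identityˡ Q)) refl)

  unit : ∀ {m} → 1 ≤ m → geometric m ⊛ 1-x^ m ≗ oneₛ
  unit {m} 1≤m = ≗-trans (⊛-comm (geometric m) (1-x^ m)) (1-x^-⊛-geometric 1≤m)

  quotient : dilate (α * β) (indicator S?) ⊛ (Gfactor ⊛ Hfactor) ≗ indicator T?
  quotient = begin
    dilate (α * β) (indicator S?) ⊛ (Gfactor ⊛ Hfactor)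
      ≈⟨ ⊛-cong source ≗-refl ⟩
    (1-x^ (P * Q) ⊛ geometric (P * β) ⊛ geometric (Q * α)) ⊛ (Gfactor ⊛ Hfactor)
      ≈⟨ ⊛-cancel-units _ _ _ _ _ _ _ (unit (ℕ.*-mono-≤ 1≤P 1≤β)) (unit (ℕ.*-mono-≤ 1≤Q 1≤α)) ⟩
    1-x^ (P * Q) ⊛ dilate P χG ⊛ dilate Q χH
      ≈⟨ ≗-sym target ⟩
    indicator T? ∎
    where open import Relation.Binary.Reasoning.Setoid (ℕ →-setoid ℤ)

⟨⟩-pair-≤P-multiples : ∀ {X Y α β P Q} → 1 ≤ X → 1 ≤ Y → 1 ≤ α → 1 ≤ β → Coprime Y X → Coprime Q P →
                       P ≡ α * X → Q ≡ β * Y → ⟨ X ∷ Y ∷ [] ⟩ ≤P ⟨ P ∷ Q ∷ [] ⟩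
⟨⟩-pair-≤P-multiples 1≤X 1≤Y 1≤α 1≤β Y⊥X Q⊥P refl refl =
  ⟨⟩-pair-≤P-gluing 1≤X 1≤Y Y⊥X 1≤α 1≤β refl refl
    (⟨⟩-pair-isGluing (ℕ.*-mono-≤ 1≤α 1≤X) (ℕ.*-mono-≤ 1≤β 1≤Y) Q⊥P) (0 , λ _ _ → tt) (0 , λ _ _ → tt)

module CoprimePowers {p q : ℕ} (1≤p : 1 ≤ p) (1≤q : 1 ≤ q) (q⊥p : Coprime q p) where

  B : ℕ → List ℕ
  B n = map (λ i → p ^ (n ∸ i) * q ^ i) (upTo (n + 1))

  ∈B⇒ : ∀ {n g} → g ∈ B n → ∃ λ i → i ≤ n × g ≡ p ^ (n ∸ i) * q ^ i
  ∈B⇒ {n} g∈ with ∈-map⁻ (λ i → p ^ (n ∸ i) * q ^ i) g∈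
  ... | i , i∈ , g≡ = i , ℕ.≤-pred (subst (i <_) (ℕ.+-comm n 1) (∈-upTo⁻ i∈)) , g≡

  ∈B⇐ : ∀ {n i} → i ≤ n → p ^ (n ∸ i) * q ^ i ∈ B n
  ∈B⇐ {n} {i} i≤n = ∈-map⁺ _ (∈-upTo⁺ (subst (i <_) (ℕ.+-comm 1 n) (s≤s i≤n)))

  p^n∈B : ∀ n → ⟨ B n ⟩ (p ^ n)
  p^n∈B n = subst ⟨ B n ⟩ (ℕ.*-identityʳ (p ^ n)) (⟨⟩-generator (∈B⇐ z≤n))

  q^n∈B : ∀ n → ⟨ B n ⟩ (q ^ n)
  q^n∈B n = subst ⟨ B n ⟩ (trans (cong (λ e → p ^ e * q ^ n) (ℕ.n∸n≡0 n)) (ℕ.*-identityˡ (q ^ n)))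
                  (⟨⟩-generator (∈B⇐ ℕ.≤-refl))

  B-positive : ∀ n → All (1 ≤_) (B n)
  B-positive n = All.tabulate λ g∈ → positive (∈B⇒ g∈)
    where
    positive : ∀ {g} → ∃ (λ i → i ≤ n × g ≡ p ^ (n ∸ i) * q ^ i) → 1 ≤ g
    positive (i , _ , refl) = ℕ.*-mono-≤ (1≤^ 1≤p (n ∸ i)) (1≤^ 1≤q i)

  B-cofinite : ∀ n → Cofinite ⟨ B n ⟩
  B-cofinite n = p ^ n * q ^ n , λ t ≤t → represent (frobenius (1≤^ 1≤p n) (1≤^ 1≤q n) pⁿ⊥qⁿ ≤t)
    where
    pⁿ⊥qⁿ = Coprime.sym (coprime-^ n n q⊥p)
    represent : ∀ {t} → ∃₂ (λ x y → t ≡ p ^ n * x + q ^ n * y) → ⟨ B n ⟩ t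
    represent (x , y , refl) =
      ⟨⟩-+ (subst ⟨ B n ⟩ (ℕ.*-comm x (p ^ n)) (⟨⟩-* x (p^n∈B n)))
           (subst ⟨ B n ⟩ (ℕ.*-comm y (q ^ n)) (⟨⟩-* y (q^n∈B n)))

  -- The generators p^{n-i} q^i of B_{1+a+c} with i ≤ c are p^{1+a} times those of B_c,
  -- the others are q^{1+c} times those of B_a.
  B-isGluing : ∀ a c → IsGluing (p ^ suc a) (q ^ suc c) ⟨ B c ⟩ ⟨ B a ⟩ ⟨ B (suc a + c) ⟩
  B-isGluing a c = record
    { 1≤P = 1≤^ 1≤p (suc a) ; 1≤Q = 1≤^ 1≤q (suc c) ; coprime = coprime-^ (suc c) (suc a) q⊥p
    ; G?  = ⟨⟩-dec (B-positive c) ; H? = ⟨⟩-dec (B-positive a) ; V? = ⟨⟩-dec (B-positive n)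
    ; G-0 = gen-zero ; G-+ = ⟨⟩-+ ; Q∈G = ⟨⟩-* q (q^n∈B c)
    ; H-+ = ⟨⟩-+ ; P∈H = ⟨⟩-* p (p^n∈B a)
    ; V⇒  = split
    ; V⇐  = λ u∈ v∈ → ⟨⟩-+ (⟨⟩-scale P low u∈) (⟨⟩-scale Q high v∈)
    }
    where
    n = suc a + c
    P = p ^ suc a
    Q = q ^ suc c

    low-≡ : ∀ i → i ≤ c → p ^ (n ∸ i) * q ^ i ≡ P * (p ^ (c ∸ i) * q ^ i)
    low-≡ i i≤c = trans (cong (λ e → p ^ e * q ^ i) (ℕ.+-∸-assoc (suc a) i≤c))
                        (trans (cong (_* q ^ i) (ℕ.^-distribˡ-+-* p (suc a) (c ∸ i))) (ℕ.*-assoc P _ _))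

    high-≡ : ∀ j → p ^ (n ∸ (suc c + j)) * q ^ (suc c + j) ≡ Q * (p ^ (a ∸ j) * q ^ j)
    high-≡ j = trans (cong₂ (λ e f → p ^ e * f) exponent (ℕ.^-distribˡ-+-* q (suc c) j))
                     (lemma (p ^ (a ∸ j)) Q (q ^ j))
      where
      exponent : n ∸ (suc c + j) ≡ a ∸ j
      exponent = trans (cong (_∸ (c + j)) (ℕ.+-comm a c)) (ℕ.[m+n]∸[m+o]≡n∸o c a j)
      lemma : ∀ x Q y → x * (Q * y) ≡ Q * (x * y)
      lemma = ℕ-Solver.solve-∀

    low : ∀ {g} → g ∈ B c → ⟨ B n ⟩ (P * g)
    low g∈ with ∈B⇒ g∈
    ... | i , i≤c , refl = subst ⟨ B n ⟩ (low-≡ i i≤c) (⟨⟩-generator (∈B⇐ (ℕ.≤-trans i≤c (ℕ.m≤n+m c (suc a)))))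

    high : ∀ {g} → g ∈ B a → ⟨ B n ⟩ (Q * g)
    high g∈ with ∈B⇒ g∈
    ... | j , j≤a , refl = subst ⟨ B n ⟩ (high-≡ j) (⟨⟩-generator (∈B⇐ 1+c+j≤n))
      where
      1+c+j≤n = subst (suc c + j ≤_) (cong suc (ℕ.+-comm c a)) (ℕ.+-monoʳ-≤ (suc c) j≤a)

    split : ∀ {t} → ⟨ B n ⟩ t → ∃₂ λ u v → ⟨ B c ⟩ u × ⟨ B a ⟩ v × t ≡ P * u + Q * v
    split gen-zero = 0 , 0 , gen-zero , gen-zero , sym (cong₂ _+_ (ℕ.*-zeroʳ P) (ℕ.*-zeroʳ Q))
    split (gen-step g∈ rest) with split rest | ∈B⇒ {n} g∈
    ... | u , v , u∈ , v∈ , t≡ | i , i≤n , refl with i ≤? c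
    ...   | yes i≤c = p ^ (c ∸ i) * q ^ i + u , v , ⟨⟩-+ (⟨⟩-generator (∈B⇐ i≤c)) u∈ , v∈ ,
                      trans (cong₂ _+_ (low-≡ i i≤c) t≡) (lemma P _ u Q v)
      where
      lemma : ∀ P x u Q v → P * x + (P * u + Q * v) ≡ P * (x + u) + Q * v
      lemma = ℕ-Solver.solve-∀
    ...   | no i≰c = u , p ^ (a ∸ j) * q ^ j + v , u∈ , ⟨⟩-+ (⟨⟩-generator (∈B⇐ j≤a)) v∈ ,
                     trans (cong₂ _+_ (trans (cong (λ i → p ^ (n ∸ i) * q ^ i) i≡) (high-≡ j)) t≡)
                           (lemma Q _ u P v)
      where
      j = i ∸ suc c
      i≡ : i ≡ suc c + j
      i≡ = sym (ℕ.m+[n∸m]≡n (ℕ.≰⇒> i≰c))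
      j≤a : j ≤ a
      j≤a = ℕ.+-cancelˡ-≤ (suc c) j a (subst₂ _≤_ i≡ (cong suc (ℕ.+-comm a c)) i≤n)
      lemma : ∀ Q x u P v → Q * x + (P * u + Q * v) ≡ P * u + Q * (x + v)
      lemma = ℕ-Solver.solve-∀

  powers-≤P : ∀ {a b m n} → a ≤ m → b ≤ n → ⟨ p ^ a ∷ q ^ b ∷ [] ⟩ ≤P ⟨ p ^ m ∷ q ^ n ∷ [] ⟩
  powers-≤P {a} {b} {m} {n} a≤m b≤n =
    ⟨⟩-pair-≤P-multiples (1≤^ 1≤p a) (1≤^ 1≤q b) (1≤^ 1≤p (m ∸ a)) (1≤^ 1≤q (n ∸ b))
      (coprime-^ b a q⊥p) (coprime-^ n m q⊥p) (^-split p a≤m) (^-split q b≤n)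

  powers-≤P-B : ∀ {n a b} → 1 ≤ a → 1 ≤ b → a + b ≤ n + 1 → ⟨ p ^ a ∷ q ^ b ∷ [] ⟩ ≤P ⟨ B n ⟩
  powers-≤P-B {n} {suc a} {b} _ 1≤b a+b≤n+1 =
    subst (λ n → ⟨ p ^ suc a ∷ q ^ b ∷ [] ⟩ ≤P ⟨ B n ⟩) (ℕ.m+[n∸m]≡n 1+a≤n)
      (⟨⟩-pair-≤P-gluing (1≤^ 1≤p (suc a)) (1≤^ 1≤q b) (coprime-^ b (suc a) q⊥p) ℕ.≤-refl (1≤^ 1≤q (suc c ∸ b))
        (sym (ℕ.*-identityˡ (p ^ suc a))) (^-split q b≤1+c) (B-isGluing a c) (B-cofinite c) (B-cofinite a))
    where
    c = n ∸ suc a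
    1+a≤n : suc a ≤ n
    1+a≤n = ℕ.+-cancelʳ-≤ 1 (suc a) n (ℕ.≤-trans (ℕ.+-monoʳ-≤ (suc a) 1≤b) a+b≤n+1)
    b≤1+c : b ≤ suc c
    b≤1+c = subst (b ≤_) (trans (ℕ.+-∸-comm 1 1+a≤n) (ℕ.+-comm c 1))
                   (subst (_≤ n + 1 ∸ suc a) (ℕ.m+n∸m≡n (suc a) b) (ℕ.∸-monoˡ-≤ (suc a) a+b≤n+1))

gcdList-∣ : ∀ ms {m} → m ∈ ms → gcdList ms ∣ m
gcdList-∣ (m ∷ ms) (here refl) = gcd[m,n]∣m m (gcdList ms)
gcdList-∣ (m ∷ ms) (there m∈)  = ∣.∣-trans (gcd[m,n]∣n m (gcdList ms)) (gcdList-∣ ms m∈)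

gcdList-positive : ∀ {ms} → ms ≢ [] → All (1 ≤_) ms → 1 ≤ gcdList ms
gcdList-positive {[]}     ms≢[] _ = contradiction refl ms≢[]
gcdList-positive {m ∷ ms} _ (1≤m All.∷ _) =
  ℕ.n≢0⇒n>0 λ gcd≡0 → ℕ.<⇒≢ 1≤m (sym (∣.0∣⇒≡0 (subst (_∣ m) gcd≡0 (gcdList-∣ (m ∷ ms) (here refl)))))

∣⇒≡*div : ∀ {d m} → 1 ≤ d → d ∣ m → m ≡ d * (m div d)
∣⇒≡*div {suc d} _ d∣m = trans (∣.m∣n⇒n≡m*quotient d∣m) (cong (suc d *_) (sym (∣.n/m≡quotient d∣m)))

module Projection (ms : List ℕ) (nₖ : ℕ) (ms≢[] : ms ≢ []) (positive : All (1 ≤_) ms) (1≤nₖ : 1 ≤ nₖ)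
                  (numerical : IsNumericalSemigroup ⟨ ms ∷ʳ nₖ ⟩) where

  d = gcdList ms
  1≤d = gcdList-positive ms≢[] positive

  Vgens Ugens : List ℕ
  Vgens = ms ∷ʳ nₖ
  Ugens = map (_div d) ms ∷ʳ nₖ

  ms-split : ∀ {m} → m ∈ ms → m ≡ d * (m div d)
  ms-split m∈ = ∣⇒≡*div 1≤d (gcdList-∣ ms m∈)

  nₖ∈V : nₖ ∈ Vgens
  nₖ∈V = ∈-++⁺ʳ ms (here refl)

  nₖ∈U : nₖ ∈ Ugens
  nₖ∈U = ∈-++⁺ʳ (map (_div d) ms) (here refl)

  V-positive : All (1 ≤_) Vgens
  V-positive = All.tabulate λ g∈ → [ All.lookup positive , (λ { (here refl) → 1≤nₖ }) ]′ (∈-++⁻ ms g∈)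

  U-positive : All (1 ≤_) Ugens
  U-positive = All.tabulate λ g∈ →
    [ quotient-positive , (λ { (here refl) → 1≤nₖ }) ]′ (∈-++⁻ (map (_div d) ms) g∈)
    where
    quotient-positive : ∀ {g} → g ∈ map (_div d) ms → 1 ≤ g
    quotient-positive g∈ with ∈-map⁻ (_div d) g∈
    ... | m , m∈ , refl = ℕ.n≢0⇒n>0 λ q≡0 →
          ℕ.<⇒≢ (All.lookup positive m∈) (sym (trans (ms-split m∈) (trans (cong (d *_) q≡0) (ℕ.*-zeroʳ d))))

  -- A common divisor of nₖ and d divides every element of V, hence two consecutive ones.
  nₖ⊥d : Coprime nₖ d
  nₖ⊥d {g} (g∣nₖ , g∣d) with IsNumericalSemigroup.cofinite numerical
  ... | N , full = ∣.∣1⇒≡1 (∣.∣m+n∣m⇒∣n (subst (g ∣_) (ℕ.+-comm 1 N) (divides-V (full (1 + N) (ℕ.n≤1+n N))))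
                                       (divides-V (full N ℕ.≤-refl)))
    where
    divides-V : ∀ {t} → ⟨ Vgens ⟩ t → g ∣ t
    divides-V gen-zero                 = g ∣.∣0
    divides-V (gen-step {a} a∈ rest) = ∣.∣m∣n⇒∣m+n (divides-generator (∈-++⁻ ms a∈)) (divides-V rest)
      where
      divides-generator : a ∈ ms ⊎ a ∈ nₖ ∷ [] → g ∣ a
      divides-generator (inj₁ a∈ms)       = ∣.∣-trans g∣d (gcdList-∣ ms a∈ms)
      divides-generator (inj₂ (here refl)) = g∣nₖ

  isGluing : IsGluing d nₖ ⟨ Ugens ⟩ U ⟨ Vgens ⟩
  isGluing = record
    { 1≤P = 1≤d ; 1≤Q = 1≤nₖ ; coprime = nₖ⊥d
    ; G?  = ⟨⟩-dec U-positive ; H? = U? ; V? = ⟨⟩-dec V-positive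
    ; G-0 = gen-zero ; G-+ = ⟨⟩-+ ; Q∈G = ⟨⟩-generator nₖ∈U ; H-+ = λ _ _ → tt ; P∈H = tt
    ; V⇒  = split
    ; V⇐  = λ {u} {v} u∈ _ → ⟨⟩-+ (⟨⟩-scale d scale-generator u∈)
                                  (subst ⟨ Vgens ⟩ (ℕ.*-comm v nₖ) (⟨⟩-* v (⟨⟩-generator nₖ∈V)))
    }
    where
    split : ∀ {t} → ⟨ Vgens ⟩ t → ∃₂ λ u v → ⟨ Ugens ⟩ u × U v × t ≡ d * u + nₖ * v
    split gen-zero = 0 , 0 , gen-zero , tt , sym (cong₂ _+_ (ℕ.*-zeroʳ d) (ℕ.*-zeroʳ nₖ))
    split (gen-step {g} g∈ rest) with split rest | ∈-++⁻ ms g∈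
    ... | u , v , u∈ , _ , t≡ | inj₁ g∈ms =
          g div d + u , v , ⟨⟩-+ (⟨⟩-generator (∈-++⁺ˡ (∈-map⁺ (_div d) g∈ms))) u∈ , tt ,
          trans (cong₂ _+_ (ms-split g∈ms) t≡) (lemma d (g div d) u nₖ v)
      where
      lemma : ∀ d x u n v → d * x + (d * u + n * v) ≡ d * (x + u) + n * v
      lemma = ℕ-Solver.solve-∀
    ... | u , v , u∈ , _ , t≡ | inj₂ (here refl) =
          u , suc v , u∈ , tt , trans (cong (nₖ +_) t≡) (lemma d u nₖ v)
      where
      lemma : ∀ d u n v → n + (d * u + n * v) ≡ d * u + n * suc v
      lemma = ℕ-Solver.solve-∀
    scale-generator : ∀ {g} → g ∈ Ugens → ⟨ Vgens ⟩ (d * g)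
    scale-generator g∈ with ∈-++⁻ (map (_div d) ms) g∈
    ... | inj₂ (here refl) = ⟨⟩-* d (⟨⟩-generator nₖ∈V)
    ... | inj₁ g∈map with ∈-map⁻ (_div d) g∈map
    ...   | m , m∈ , refl = subst ⟨ Vgens ⟩ (ms-split m∈) (⟨⟩-generator (∈-++⁺ˡ m∈))

  -- V = d U + nₖ ℕ gives H_V(x) = H_U(x^d) (1 - x^{d nₖ}) / (1 - x^{nₖ}).
  U≤PV : ⟨ Ugens ⟩ ≤P ⟨ Vgens ⟩
  U≤PV = ≤P-intro G? V? 1≤d (1-x^ (nₖ * d) ⊛ geometric nₖ)
           (proj₂ (1-x^-⊛-dilate-polynomial 1≤nₖ d U? (0 , λ _ _ → tt)))
           (≗-trans (≗-sym (⊛-assoc (dilate d χU) _ _))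
             (≗-trans (⊛-cong (⊛-comm (dilate d χU) _) ≗-refl) (≗-sym target)))
    where
    open IsGluing isGluing using (G?; V?)
    χU = indicator G?
    target : indicator V? ≗ 1-x^ (nₖ * d) ⊛ dilate d χU ⊛ geometric nₖ
    target = ≗-trans (≗-sym (dilate-1 _))
                     (Gluing.gluing isGluing ℕ.≤-refl (sym (ℕ.*-identityˡ d)) (sym (ℕ.*-identityˡ nₖ))
                                    (ℕ.*-comm nₖ d))

mainTheorem17 :
    (∀ (p q : ℕ) → Prime p → Prime q → p ≢ q →
      (∀ (a b m n : ℕ) → 1 ≤ a → a ≤ m → 1 ≤ b → b ≤ n →
        ⟨ p ^ a ∷ q ^ b ∷ [] ⟩ ≤P ⟨ p ^ m ∷ q ^ n ∷ [] ⟩)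
      ×
      (∀ (n a b : ℕ) → 1 ≤ n → 1 ≤ a → 1 ≤ b → 2 ≤ a + b → a + b ≤ n + 1 →
        ⟨ p ^ a ∷ q ^ b ∷ [] ⟩ ≤P ⟨ map (λ i → p ^ (n ∸ i) * q ^ i) (upTo (n + 1)) ⟩))
    ×
    (∀ (ms : List ℕ) (nk : ℕ) → ms ≢ [] → All (1 ≤_) ms → 1 ≤ nk →
      IsNumericalSemigroup ⟨ ms ∷ʳ nk ⟩ →
      ⟨ map (λ x → x div gcdList ms) ms ∷ʳ nk ⟩ ≤P ⟨ ms ∷ʳ nk ⟩)
mainTheorem17 =
  (λ p q pp pq p≢q →
    let open CoprimePowers (1≤prime pp) (1≤prime pq) (distinct-primes-coprime pq pp (p≢q ∘ sym)) in
    (λ _ _ _ _ _ a≤m _ b≤n → powers-≤P a≤m b≤n) , (λ _ _ _ _ 1≤a 1≤b _ → powers-≤P-B 1≤a 1≤b)) ,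
  Projection.U≤PV
  where
  1≤prime : ∀ {p} → Prime p → 1 ≤ p
  1≤prime {p} pp = ℕ.>-nonZero⁻¹ p {{prime⇒nonZero pp}}
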